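{- Let $G$ and $B$ be finite sets. For each $g \in G$ let $B_g \subseteq B$ and for each $b \in B$ let $G_b \subseteq G$. Put $G_L = \{g \in G : B_g \neq \varnothing\}$ and $B_L = \{b \in B : G_b \neq \varnothing\}$. For $g \in G_L$ let $B^*_g = \{b \in B_g : b \notin B_L \text{ or } g \in G_b\}$, and for $b \in B_L$ let $G^*_b = \{g \in G_b : g \notin G_L \text{ or } b \in B_g\}$. Then there exists an injective partial function $P : G \to B$ with $G_L \subseteq \mathrm{Domain}(P)$, $B_L \subseteq \mathrm{Range}(P)$, $P(g) \in B_g$ for all $g \in G_L$, and $P^{ -1}(b) \in G_b$ for all $b \in B_L$, if and only if both of the following hold: (i) there is an injective function $T_1 : G_L \to B$ with $T_1(g) \in B^*_g$ for all $g \in G_L$; (ii) there is an injective function $T_2 : B_L \to G$ with $T_2(b) \in G^*_b$ for all $b \in B_L$.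
   Context: This is the "Symmetric Marriage Problem": $G$ is a set of girls and $B$ a set of boys; $B_g$ is the list of boys girl $g$ is willing to marry and $G_b$ the list of girls boy $b$ is willing to marry. An empty list $B_g=\varnothing$ (resp. $G_b=\varnothing$) has the special meaning that $g$ (resp. $b$) has no list, i.e. is willing to marry anyone or no one; $G_L$ and $B_L$ are the sets of girls and boys who have lists. A partial function $P$ as in the claim is called a solution of the instance. -}

module Defs where

open import Data.Nat using (ℕ)
open import Data.Fin using (Fin)
open import Data.Fin.Subset using (Subset; _∈_; _∉_; Nonempty)
open import Data.Maybe using (Maybe; just)
open import Data.Product using (Σ; ∃; _×_; proj₁)
open import Data.Sum using (_⊎_)
open import Relation.Nullary using (¬_)
open import Relation.Binary.PropositionalEquality using (_≡_)

-- An instance: girls G = Fin m, boys B = Fin n,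
-- Bs g = B_g ⊆ B, Gs b = G_b ⊆ G.  (Empty list = "has no list".)

module _ {m n : ℕ} (Bs : Fin m → Subset n) (Gs : Fin n → Subset m) where

  InGL : Fin m → Set
  InGL g = Nonempty (Bs g)

  InBL : Fin n → Set
  InBL b = Nonempty (Gs b)

  GL : Set
  GL = Σ (Fin m) InGL

  BL : Set
  BL = Σ (Fin n) InBL

  InBstar : Fin m → Fin n → Set
  InBstar g b = b ∈ Bs g × (¬ InBL b ⊎ g ∈ Gs b)

  InGstar : Fin n → Fin m → Set
  InGstar b g = g ∈ Gs b × (¬ InGL g ⊎ b ∈ Bs g)

  IsSolution : (Fin m → Maybe (Fin n)) → Set
  IsSolution P =
      (∀ g g' b → P g ≡ just b → P g' ≡ just b → g ≡ g')
    × (∀ g → InGL g → ∃ λ b → P g ≡ just b × b ∈ Bs g)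
    × (∀ b → InBL b → ∃ λ g → P g ≡ just b × g ∈ Gs b)

  CondI : Set
  CondI = Σ (GL → Fin n) λ T₁ →
      (∀ x y → T₁ x ≡ T₁ y → proj₁ x ≡ proj₁ y)
    × (∀ x → InBstar (proj₁ x) (T₁ x))

  CondII : Set
  CondII = Σ (BL → Fin m) λ T₂ →
      (∀ x y → T₂ x ≡ T₂ y → proj₁ x ≡ proj₁ y)
    × (∀ x → InGstar (proj₁ x) (T₂ x))

-- The forward direction is immediate: a solution P restricted to G_L is an
-- admissible T₁, and P⁻¹ restricted to B_L is an admissible T₂.
--
-- The backward direction is a finite Schröder–Bernstein argument.  T₁ and T₂
-- give partial injections f : G ⇀ B (domain G_L) and h : B ⇀ G (domain B_L).
-- Following the edges of f and h backwards from a girl g,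
--     g ←h b ←f g' ←h b' ←f …,
-- the chain either cycles, stops at a girl outside Ran h, or stops at a boy
-- outside Ran f.  Matching g along h⁻¹ exactly when her chain stops at a boy,
-- and along f otherwise, yields an injective P whose domain contains Dom f,
-- whose range contains Dom h, and all of whose edges are f- or h-edges.  The
-- starred conditions on T₁ and T₂ then say exactly that every such edge is
-- acceptable to whoever has a list.

module Submission where

open import Data.Nat using (ℕ; zero; suc; _∸_; _≤_; _<_; z≤n; s≤s)
open import Data.Nat.Properties using (∸-cancelˡ-≡; <-irrefl)
open import Data.Fin using (Fin; toℕ; _≟_)
open import Data.Fin.Properties using (any?; injective⇒≤; toℕ-injective; toℕ≤pred[n])
open import Data.Fin.Subset using (Subset; _∈_)
open import Data.Fin.Subset.Properties using (nonempty?)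
open import Data.Maybe using (Maybe; just; nothing; fromMaybe)
open import Data.Maybe.Properties using (≡-dec; just-injective)
open import Data.Bool using (Bool; true; false)
open import Data.Product using (Σ; ∃; _×_; _,_; proj₁; proj₂)
open import Data.Sum using (_⊎_; inj₁; inj₂; [_,_]′)
open import Data.Empty using (⊥-elim)
open import Function using (id; const)
open import Function.Bundles using (_⇔_; mk⇔)
open import Relation.Nullary using (yes; no)
open import Relation.Unary using (Decidable)
open import Relation.Binary.PropositionalEquality

open import Defs

-- A partial map `step` on a finite set in which each point either continues
-- to another point (inj₁) or exits with a label (inj₂).  `exit g` is the label
-- at which the chain from g exits, or nothing if it never does.
module ChainExit {m : ℕ} {X : Set} (step : Fin m → Fin m ⊎ X) where

  data Exits : Fin m → ℕ → X → Set where
    here  : ∀ {g x} → step g ≡ inj₂ x → Exits g zero x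
    there : ∀ {g g' t x} → step g ≡ inj₁ g' → Exits g' t x → Exits g (suc t) x

  exits-unique : ∀ {g t t' x x'} → Exits g t x → Exits g t' x' → t ≡ t'
  exits-unique (here _) (here _) = refl
  exits-unique (here e) (there e' _) with trans (sym e) e'
  ... | ()
  exits-unique (there e _) (here e') with trans (sym e) e'
  ... | ()
  exits-unique (there e r) (there e' r') with trans (sym e) e'
  ... | refl = cong suc (exits-unique r r')

  -- The point reached after i steps (stalling once the chain exits).
  walk : ℕ → Fin m → Fin m
  walk zero    g = g
  walk (suc i) g = [ walk i , const g ]′ (step g)

  walk-exits : ∀ {g k x} i → Exits g k x → i ≤ k → Exits (walk i g) (k ∸ i) x
  walk-exits zero    r           z≤n       = r
  walk-exits (suc i) (there e r) (s≤s i≤k) rewrite e = walk-exits i r i≤k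

  -- Pigeonhole: a chain that exits after k steps visits k + 1 distinct
  -- points, since the i-th of them exits after exactly k ∸ i further steps.
  exits-bound : ∀ {g k x} → Exits g k x → k < m
  exits-bound {g} {k} r = injective⇒≤ trajectory-injective
    where
    trajectory : Fin (suc k) → Fin m
    trajectory i = walk (toℕ i) g

    trajectory-injective : ∀ {i j} → trajectory i ≡ trajectory j → i ≡ j
    trajectory-injective {i} {j} e = toℕ-injective (∸-cancelˡ-≡ (toℕ≤pred[n] i) (toℕ≤pred[n] j)
      (exits-unique (subst (λ p → Exits p _ _) e (walk-exits (toℕ i) r (toℕ≤pred[n] i)))
                    (walk-exits (toℕ j) r (toℕ≤pred[n] j))))

  run : ℕ → Fin m → Maybe X
  run zero    g = nothing
  run (suc k) g = [ run k , just ]′ (step g)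

  run-mono : ∀ {x} k g → run k g ≡ just x → run (suc k) g ≡ just x
  run-mono (suc k) g e with step g
  ... | inj₁ g' = run-mono k g' e
  ... | inj₂ _  = e

  exits-from-run : ∀ {x} k g → run k g ≡ nothing → run (suc k) g ≡ just x → Exits g k x
  exits-from-run zero g _ e with step g in eq
  ... | inj₂ _ with e
  ...   | refl = here eq
  exits-from-run (suc k) g e e' with step g in eq
  ... | inj₁ g' = there eq (exits-from-run k g' e e')

  -- Fuel m suffices, by the pigeonhole bound.
  run-stable : ∀ g → run (suc m) g ≡ run m g
  run-stable g with run m g in e
  ... | just _  = run-mono m g e
  ... | nothing with run (suc m) g in e'
  ...   | nothing = refl
  ...   | just _  = ⊥-elim (<-irrefl refl (exits-bound (exits-from-run m g e e')))

  exit : Fin m → Maybe X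
  exit = run m

  exit-step : ∀ g → exit g ≡ [ exit , just ]′ (step g)
  exit-step g = sym (run-stable g)

PartialInjective : ∀ {k l} → (Fin k → Maybe (Fin l)) → Set
PartialInjective f = ∀ x x' y → f x ≡ just y → f x' ≡ just y → x ≡ x'

module Preimage {k l : ℕ} (f : Fin k → Maybe (Fin l)) where

  preimage : Fin l → Maybe (Fin k)
  preimage y with any? (λ x → ≡-dec _≟_ (f x) (just y))
  ... | yes (x , _) = just x
  ... | no _        = nothing

  preimage-sound : ∀ {x y} → preimage y ≡ just x → f x ≡ just y
  preimage-sound {y = y} with any? (λ x → ≡-dec _≟_ (f x) (just y))
  ... | yes (_ , fx) = λ { refl → fx }
  ... | no _         = λ ()

  preimage-complete : PartialInjective f → ∀ {x y} → f x ≡ just y → preimage y ≡ just x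
  preimage-complete f-inj {x} {y} fx with any? (λ x → ≡-dec _≟_ (f x) (just y))
  ... | yes (x' , fx') = cong just (f-inj x' x y fx' fx)
  ... | no ¬any        = ⊥-elim (¬any (x , fx))

module Restriction {k l : ℕ} {Dom : Fin k → Set} (dom? : Decidable Dom)
                   (T : Σ (Fin k) Dom → Fin l) where

  partial : Fin k → Maybe (Fin l)
  partial x with dom? x
  ... | yes d = just (T (x , d))
  ... | no _  = nothing

  partial-sound : ∀ {x y} → partial x ≡ just y → Σ (Dom x) λ d → T (x , d) ≡ y
  partial-sound {x} with dom? x
  ... | yes d = λ { refl → d , refl }
  ... | no _  = λ ()

  partial-defined : ∀ {x} → Dom x → ∃ λ y → partial x ≡ just y
  partial-defined {x} d with dom? x
  ... | yes _ = _ , refl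
  ... | no ¬d = ⊥-elim (¬d d)

  partial-injective : (∀ u v → T u ≡ T v → proj₁ u ≡ proj₁ v) → PartialInjective partial
  partial-injective T-inj x x' y e e' with partial-sound e | partial-sound e'
  ... | d , Tx | d' , Tx' = T-inj (x , d) (x' , d') (trans Tx (sym Tx'))

module SchröderBernstein {m n : ℕ}
  (f : Fin m → Maybe (Fin n)) (f-inj : PartialInjective f)
  (h : Fin n → Maybe (Fin m)) (h-inj : PartialInjective h) where

  open Preimage using (preimage; preimage-sound; preimage-complete)

  -- One step back along g ←h b ←f g'.  The chain stops with `false` at a girl
  -- outside Ran h and with `true` at a boy outside Ran f.
  back : Fin m → Fin m ⊎ Bool
  back g with preimage h g
  ... | nothing = inj₂ false
  ... | just b with preimage f b
  ...   | nothing = inj₂ true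
  ...   | just g' = inj₁ g'

  back-girl-end : ∀ {g} → preimage h g ≡ nothing → back g ≡ inj₂ false
  back-girl-end e rewrite e = refl

  back-boy-end : ∀ {g b} → h b ≡ just g → preimage f b ≡ nothing → back g ≡ inj₂ true
  back-boy-end hb e rewrite preimage-complete h h-inj hb | e = refl

  back-continue : ∀ {g g' b} → h b ≡ just g → f g' ≡ just b → back g ≡ inj₁ g'
  back-continue hb fb rewrite preimage-complete h h-inj hb | preimage-complete f f-inj fb = refl

  open ChainExit back using (exit; exit-step)

  fromBoy : Fin m → Bool
  fromBoy g = fromMaybe false (exit g)

  fromBoy-step : ∀ g → fromBoy g ≡ [ fromBoy , id ]′ (back g)
  fromBoy-step g = trans (cong (fromMaybe false) (exit-step g)) (unfold (back g))
    where
    unfold : ∀ s → fromMaybe false ([ exit , just ]′ s) ≡ [ fromBoy , id ]′ s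
    unfold (inj₁ _) = refl
    unfold (inj₂ _) = refl

  fromBoy-continue : ∀ {g g'} → back g ≡ inj₁ g' → fromBoy g ≡ fromBoy g'
  fromBoy-continue {g} e = trans (fromBoy-step g) (cong [ fromBoy , id ]′ e)

  fromBoy-stop : ∀ {g x} → back g ≡ inj₂ x → fromBoy g ≡ x
  fromBoy-stop {g} e = trans (fromBoy-step g) (cong [ fromBoy , id ]′ e)

  choose : Bool → Fin m → Maybe (Fin n)
  choose true  = preimage h
  choose false = f

  P : Fin m → Maybe (Fin n)
  P g = choose (fromBoy g) g

  P-along-h : ∀ {g} → fromBoy g ≡ true → P g ≡ preimage h g
  P-along-h {g} e = cong (λ c → choose c g) e

  P-along-f : ∀ {g} → fromBoy g ≡ false → P g ≡ f g
  P-along-f {g} e = cong (λ c → choose c g) e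

  P-edge : ∀ g b → P g ≡ just b → f g ≡ just b ⊎ h b ≡ just g
  P-edge g b Pg with fromBoy g
  ... | true  = inj₂ (preimage-sound h Pg)
  ... | false = inj₁ Pg

  -- An h-edge into a girl matched along h and an f-edge out of a girl matched
  -- along f cannot share a boy: the two girls lie on the same chain.
  no-mixed-edge : ∀ {g₁ g₂ b} → h b ≡ just g₁ → f g₂ ≡ just b →
                  fromBoy g₁ ≡ true → fromBoy g₂ ≡ false → g₁ ≡ g₂
  no-mixed-edge hb fb e₁ e₂ with trans (sym e₁) (trans (fromBoy-continue (back-continue hb fb)) e₂)
  ... | ()

  P-injective : PartialInjective P
  P-injective g₁ g₂ b p₁ p₂ with fromBoy g₁ in e₁ | fromBoy g₂ in e₂
  ... | true  | true  = just-injective (trans (sym (preimage-sound h p₁)) (preimage-sound h p₂))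
  ... | false | false = f-inj g₁ g₂ b p₁ p₂
  ... | true  | false = no-mixed-edge (preimage-sound h p₁) p₂ e₁ e₂
  ... | false | true  = sym (no-mixed-edge (preimage-sound h p₂) p₁ e₂ e₁)

  -- Dom f ⊆ Dom P: a chain stopping at a boy passes through h⁻¹ g.
  P-covers-dom-f : ∀ {g b} → f g ≡ just b → ∃ λ b' → P g ≡ just b'
  P-covers-dom-f {g} {b} fb with fromBoy g in e
  ... | false = b , fb
  ... | true with preimage h g in pre
  ...   | just b' = b' , refl
  ...   | nothing with trans (sym e) (fromBoy-stop (back-girl-end pre))
  ...     | ()

  -- Dom h ⊆ Ran P: if g = h b is matched along f, then so is the girl f⁻¹ b.
  P-covers-dom-h : ∀ {b g} → h b ≡ just g → ∃ λ g' → P g' ≡ just b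
  P-covers-dom-h {b} {g} hb with fromBoy g in e
  ... | true = g , trans (P-along-h e) (preimage-complete h h-inj hb)
  ... | false with preimage f b in pre
  ...   | just g' = g' , trans (P-along-f same-chain) (preimage-sound f pre)
    where
    same-chain : fromBoy g' ≡ false
    same-chain = trans (sym (fromBoy-continue (back-continue hb (preimage-sound f pre)))) e
  ...   | nothing with trans (sym e) (fromBoy-stop (back-boy-end hb pre))
  ...     | ()

module _ {m n : ℕ} (Bs : Fin m → Subset n) (Gs : Fin n → Subset m) where

  solution⇒condI : Σ (Fin m → Maybe (Fin n)) (IsSolution Bs Gs) → CondI Bs Gs
  solution⇒condI (P , P-inj , covG , covB) = T₁ , T₁-injective , T₁-admissible
    where
    T₁ : GL Bs Gs → Fin n
    T₁ (g , ne) = proj₁ (covG g ne)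

    T₁-injective : ∀ x y → T₁ x ≡ T₁ y → proj₁ x ≡ proj₁ y
    T₁-injective (g , ne) (g' , ne') e =
      P-inj g g' _ (trans (proj₁ (proj₂ (covG g ne))) (cong just e)) (proj₁ (proj₂ (covG g' ne')))

    T₁-admissible : ∀ x → InBstar Bs Gs (proj₁ x) (T₁ x)
    T₁-admissible (g , ne) with covG g ne
    ... | b , Pg , b∈Bg with nonempty? (Gs b)
    ...   | no ¬listed = b∈Bg , inj₁ ¬listed
    ...   | yes listed with covB b listed
    ...     | g' , Pg' , g'∈Gb with P-inj g g' b Pg Pg'
    ...       | refl = b∈Bg , inj₂ g'∈Gb

  solution⇒condII : Σ (Fin m → Maybe (Fin n)) (IsSolution Bs Gs) → CondII Bs Gs
  solution⇒condII (P , P-inj , covG , covB) = T₂ , T₂-injective , T₂-admissible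
    where
    T₂ : BL Bs Gs → Fin m
    T₂ (b , ne) = proj₁ (covB b ne)

    T₂-injective : ∀ x y → T₂ x ≡ T₂ y → proj₁ x ≡ proj₁ y
    T₂-injective (b , ne) (b' , ne') e = just-injective (trans (sym (proj₁ (proj₂ (covB b ne))))
      (subst (λ g → P g ≡ just b') (sym e) (proj₁ (proj₂ (covB b' ne')))))

    T₂-admissible : ∀ x → InGstar Bs Gs (proj₁ x) (T₂ x)
    T₂-admissible (b , ne) with covB b ne
    ... | g , Pg , g∈Gb with nonempty? (Bs g)
    ...   | no ¬listed = g∈Gb , inj₁ ¬listed
    ...   | yes listed with covG g listed
    ...     | b' , Pb' , b'∈Bg with trans (sym Pb') Pg
    ...       | refl = g∈Gb , inj₂ b'∈Bg

  conditions⇒solution : CondI Bs Gs × CondII Bs Gs → Σ (Fin m → Maybe (Fin n)) (IsSolution Bs Gs)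
  conditions⇒solution ((T₁ , T₁-inj , T₁-adm) , (T₂ , T₂-inj , T₂-adm)) =
    P , P-injective , covers-girls , covers-boys
    where
    module F = Restriction (λ g → nonempty? (Bs g)) T₁
    module H = Restriction (λ b → nonempty? (Gs b)) T₂
    open SchröderBernstein F.partial (F.partial-injective T₁-inj) H.partial (H.partial-injective T₂-inj)

    girl-accepts : ∀ {g b} → InGL Bs Gs g → F.partial g ≡ just b ⊎ H.partial b ≡ just g → b ∈ Bs g
    girl-accepts _ (inj₁ fb) with F.partial-sound fb
    ... | d , refl = proj₁ (T₁-adm (_ , d))
    girl-accepts listed (inj₂ hb) with H.partial-sound hb
    ... | d , refl with proj₂ (T₂-adm (_ , d))
    ...   | inj₁ ¬listed = ⊥-elim (¬listed listed)
    ...   | inj₂ b∈Bg    = b∈Bg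

    boy-accepts : ∀ {g b} → InBL Bs Gs b → F.partial g ≡ just b ⊎ H.partial b ≡ just g → g ∈ Gs b
    boy-accepts listed (inj₁ fb) with F.partial-sound fb
    ... | d , refl with proj₂ (T₁-adm (_ , d))
    ...   | inj₁ ¬listed = ⊥-elim (¬listed listed)
    ...   | inj₂ g∈Gb    = g∈Gb
    boy-accepts _ (inj₂ hb) with H.partial-sound hb
    ... | d , refl = proj₁ (T₂-adm (_ , d))

    covers-girls : ∀ g → InGL Bs Gs g → ∃ λ b → P g ≡ just b × b ∈ Bs g
    covers-girls g listed with P-covers-dom-f (proj₂ (F.partial-defined listed))
    ... | b , Pg = b , Pg , girl-accepts listed (P-edge g b Pg)

    covers-boys : ∀ b → InBL Bs Gs b → ∃ λ g → P g ≡ just b × g ∈ Gs b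
    covers-boys b listed with P-covers-dom-h (proj₂ (H.partial-defined listed))
    ... | g , Pg = g , Pg , boy-accepts listed (P-edge g b Pg)

theorem2 : (m n : ℕ) (Bs : Fin m → Subset n) (Gs : Fin n → Subset m) →
    (Σ (Fin m → Maybe (Fin n)) (IsSolution Bs Gs)) ⇔ (CondI Bs Gs × CondII Bs Gs)
theorem2 m n Bs Gs = mk⇔
  (λ sol → solution⇒condI Bs Gs sol , solution⇒condII Bs Gs sol)
  (conditions⇒solution Bs Gs)
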